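{- Let ${\sf V}$ be a quantale in which every element is the supremum of a set of coprime elements, and let $c:{\sf P}X\to{\sf V}^X$ satisfy (R) ${\sf k}\le (cA)(x)$ whenever $x\in A\subseteq X$, and (A) $(c\emptyset)(x)=\bot$ and $c(A\cup B)(x)=(cA)(x)\vee(cB)(x)$ for all $A,B\subseteq X$, $x\in X$. Define $\overline{c}:{\sf P}X\to{\sf V}^X$ by $(\overline{c}A)(x)=\bigvee_{v\in{\sf V}} v\otimes c(c^vA)(x)$, where $c^vA=\{z\in X\mid v\le (cA)(z)\}$. Then $\overline{c}$ also satisfies (R) and (A).
   Context: A quantale ${\sf V}=({\sf V},\otimes,{\sf k})$ is a complete lattice with a (not necessarily commutative) monoid structure $(\otimes,{\sf k})$ such that $\otimes$ preserves arbitrary suprema in each variable. An element $p$ of ${\sf V}$ is coprime if $p>\bot$ and, for all $u,v$, $p\le u\vee v$ implies $p\le u$ or $p\le v$. ${\sf P}X$ is the power set of the set $X$ and ${\sf V}^X$ the set of maps $X\to{\sf V}$, ordered pointwise. -}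

module Defs where

open import Level using (Level; suc; Lift)
open import Data.Empty using (⊥)
open import Data.Sum using (_⊎_)
open import Data.Product using (Σ; _×_; _,_)
open import Relation.Binary.PropositionalEquality using (_≡_; _≢_)
open import Relation.Binary.Structures using (IsPartialOrder)
open import Relation.Unary using (Pred)
open import Function.Bundles using (_⇔_)

record Quantale (ℓ : Level) : Set (suc ℓ) where
  infixl 7 _⊗_
  infix 4 _≤_
  field
    Carrier        : Set ℓ
    _≤_            : Carrier → Carrier → Set ℓ
    isPartialOrder : IsPartialOrder _≡_ _≤_
    ⋁              : Pred Carrier ℓ → Carrier
    ⋁-upper        : ∀ (S : Pred Carrier ℓ) x → S x → x ≤ ⋁ S
    ⋁-least        : ∀ (S : Pred Carrier ℓ) y → (∀ x → S x → x ≤ y) → ⋁ S ≤ y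
    _⊗_            : Carrier → Carrier → Carrier
    k              : Carrier
    ⊗-assoc        : ∀ a b c → (a ⊗ b) ⊗ c ≡ a ⊗ (b ⊗ c)
    ⊗-identityˡ    : ∀ a → k ⊗ a ≡ a
    ⊗-identityʳ    : ∀ a → a ⊗ k ≡ a
    ⊗-⋁ˡ           : ∀ a (S : Pred Carrier ℓ) →
                     a ⊗ ⋁ S ≡ ⋁ (λ y → Σ Carrier λ x → S x × (y ≡ a ⊗ x))
    ⊗-⋁ʳ           : ∀ (S : Pred Carrier ℓ) a →
                     ⋁ S ⊗ a ≡ ⋁ (λ y → Σ Carrier λ x → S x × (y ≡ x ⊗ a))

  ⊥V : Carrier
  ⊥V = ⋁ (λ _ → Lift ℓ ⊥)

  infixr 6 _∨_
  _∨_ : Carrier → Carrier → Carrier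
  a ∨ b = ⋁ (λ x → (x ≡ a) ⊎ (x ≡ b))

  ⋁[v]_ : (Carrier → Carrier) → Carrier
  ⋁[v] f = ⋁ (λ y → Σ Carrier λ v → y ≡ f v)

  Coprime : Carrier → Set ℓ
  Coprime p = (⊥V ≤ p × p ≢ ⊥V) × (∀ u v → p ≤ u ∨ v → (p ≤ u) ⊎ (p ≤ v))

  CoprimeGenerated : Set (suc ℓ)
  CoprimeGenerated =
    ∀ u → Σ (Pred Carrier ℓ) λ S → (∀ p → S p → Coprime p) × (u ≡ ⋁ S)

module _ {ℓ : Level} (V : Quantale ℓ) (X : Set ℓ) where
  open Quantale V

  ∅ : Pred X ℓ
  ∅ = λ _ → Lift ℓ ⊥

  _∪_ : Pred X ℓ → Pred X ℓ → Pred X ℓ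
  A ∪ B = λ x → A x ⊎ B x

  -- c is a map P X → V^X; since subsets are predicates, we require that c
  -- respects extensional equality of subsets (i.e. it is a map on sets).
  Extensional : (Pred X ℓ → X → Carrier) → Set (suc ℓ)
  Extensional c = ∀ (A B : Pred X ℓ) → (∀ x → A x ⇔ B x) → ∀ x → c A x ≡ c B x

  CondR : (Pred X ℓ → X → Carrier) → Set (suc ℓ)
  CondR c = ∀ (A : Pred X ℓ) x → A x → k ≤ c A x

  CondA : (Pred X ℓ → X → Carrier) → Set (suc ℓ)
  CondA c = (∀ x → c ∅ x ≡ ⊥V)
          × (∀ (A B : Pred X ℓ) x → c (A ∪ B) x ≡ c A x ∨ c B x)

  cUp : (Pred X ℓ → X → Carrier) → Carrier → Pred X ℓ → Pred X ℓ
  cUp c v A = λ z → v ≤ c A z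

  cBar : (Pred X ℓ → X → Carrier) → Pred X ℓ → X → Carrier
  cBar c A x = ⋁[v] (λ v → v ⊗ c (cUp c v A) x)

-- Since ⊗ preserves joins in its left argument
-- and v is a join of coprimes, each term is bounded by the terms p ⊗ c(cᵛA)(x) with p ≤ v coprime,
-- and as cᵛA ⊆ cᵖA these are bounded by p ⊗ c(cᵖA)(x). For coprime p the set cᵖ(A ∪ B) splits as
-- cᵖA ∪ cᵖB, because (A) makes c(A ∪ B)(z) a binary join, and cᵖ∅ is empty, because p ≰ ⊥.
-- Additivity of c then gives (A) for c̄; (R) comes from the term v = k.
module Submission where

open import Defs
open import Level using (Level; lift; suc)
open import Data.Product using (_×_; _,_)
open import Data.Sum using (inj₁; inj₂; [_,_])
open import Data.Empty using (⊥-elim)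
open import Relation.Nullary using (¬_)
open import Relation.Unary using (Pred; _⊆_)
open import Relation.Binary.PropositionalEquality using (_≡_; refl; sym; cong)
open import Relation.Binary.Structures using (IsPartialOrder)
open import Function.Bundles using (mk⇔)

module QuantaleProperties {ℓ : Level} (V : Quantale ℓ) where
  open Quantale V
  open IsPartialOrder isPartialOrder public
    using (antisym) renaming (refl to ≤-refl; trans to ≤-trans)

  ≤-respˡ-≡ : ∀ {a b d} → a ≡ b → b ≤ d → a ≤ d
  ≤-respˡ-≡ refl b≤d = b≤d

  ≤-respʳ-≡ : ∀ {a b d} → a ≤ b → b ≡ d → a ≤ d
  ≤-respʳ-≡ a≤b refl = a≤b

  ⊥V-least : ∀ a → ⊥V ≤ a
  ⊥V-least a = ⋁-least _ a λ { _ (lift ()) }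

  ∨-upperˡ : ∀ a b → a ≤ a ∨ b
  ∨-upperˡ a b = ⋁-upper _ a (inj₁ refl)

  ∨-upperʳ : ∀ a b → b ≤ a ∨ b
  ∨-upperʳ a b = ⋁-upper _ b (inj₂ refl)

  ∨-least : ∀ {a b y} → a ≤ y → b ≤ y → a ∨ b ≤ y
  ∨-least a≤y b≤y = ⋁-least _ _ λ { _ (inj₁ refl) → a≤y ; _ (inj₂ refl) → b≤y }

  ∨-mono-≤ : ∀ {a a′ b b′} → a ≤ a′ → b ≤ b′ → a ∨ b ≤ a′ ∨ b′
  ∨-mono-≤ {a′ = a′} {b′ = b′} a≤a′ b≤b′ =
    ∨-least (≤-trans a≤a′ (∨-upperˡ a′ b′)) (≤-trans b≤b′ (∨-upperʳ a′ b′))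

  ≤⇒∨≡ : ∀ {a b} → a ≤ b → a ∨ b ≡ b
  ≤⇒∨≡ {a} {b} a≤b = antisym (∨-least a≤b ≤-refl) (∨-upperʳ a b)

  ⊗-distribˡ-∨-≤ : ∀ u a b → u ⊗ (a ∨ b) ≤ u ⊗ a ∨ u ⊗ b
  ⊗-distribˡ-∨-≤ u a b = ≤-respˡ-≡ (⊗-⋁ˡ u _) (⋁-least _ _ λ
    { _ (_ , inj₁ refl , refl) → ∨-upperˡ (u ⊗ a) (u ⊗ b)
    ; _ (_ , inj₂ refl , refl) → ∨-upperʳ (u ⊗ a) (u ⊗ b) })

  ⊗-monoʳ-≤ : ∀ u {a b} → a ≤ b → u ⊗ a ≤ u ⊗ b
  ⊗-monoʳ-≤ u {a} {b} a≤b =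
    ≤-respʳ-≡ (≤-respʳ-≡ (⋁-upper _ (u ⊗ a) (a , inj₁ refl , refl)) (sym (⊗-⋁ˡ u _)))
              (cong (u ⊗_) (≤⇒∨≡ a≤b))

  ⊗-zeroʳ : ∀ u → u ⊗ ⊥V ≡ ⊥V
  ⊗-zeroʳ u = antisym (≤-respˡ-≡ (⊗-⋁ˡ u _) (⋁-least _ _ λ { _ (_ , lift () , _) }))
                      (⊥V-least (u ⊗ ⊥V))

  coprime⇒≰⊥ : ∀ {p} → Coprime p → ¬ p ≤ ⊥V
  coprime⇒≰⊥ {p} ((_ , p≢⊥) , _) p≤⊥ = p≢⊥ (antisym p≤⊥ (⊥V-least p))

  ⊗-≤-by-coprimes : CoprimeGenerated → ∀ v w y →
                    (∀ p → Coprime p → p ≤ v → p ⊗ w ≤ y) → v ⊗ w ≤ y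
  ⊗-≤-by-coprimes coprimeGenerated v w y bound with coprimeGenerated v
  ... | S , coprimeS , v≡⋁S =
    ≤-respˡ-≡ (cong (_⊗ w) v≡⋁S) (≤-respˡ-≡ (⊗-⋁ʳ S w) (⋁-least _ y λ
      { _ (p , Sp , refl) → bound p (coprimeS p Sp) (≤-respʳ-≡ (⋁-upper S p Sp) (sym v≡⋁S)) }))

module OperatorProperties {ℓ : Level} (V : Quantale ℓ) (X : Set ℓ)
  (c : Pred X ℓ → X → Quantale.Carrier V) where
  open Quantale V
  open QuantaleProperties V

  Monotone : Set (suc ℓ)
  Monotone = ∀ {A B : Pred X ℓ} → A ⊆ B → ∀ x → c A x ≤ c B x

  extensional∧additive⇒monotone : Extensional V X c → CondA V X c → Monotone
  extensional∧additive⇒monotone ext (_ , c-∪) {A} {B} A⊆B x =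
    ≤-respʳ-≡ (≤-respʳ-≡ (∨-upperˡ (c A x) (c B x)) (sym (c-∪ A B x)))
              (ext (_∪_ V X A B) B (λ _ → mk⇔ [ A⊆B , (λ b → b) ] inj₂) x)

  cUp-antitone : ∀ {u v} A → u ≤ v → cUp V X c v A ⊆ cUp V X c u A
  cUp-antitone A u≤v v≤cAz = ≤-trans u≤v v≤cAz

  cUp-∅ : CondA V X c → ∀ {p} → Coprime p → cUp V X c p (∅ V X) ⊆ ∅ V X
  cUp-∅ (c-∅ , _) coprime {z} p≤c∅z = ⊥-elim (coprime⇒≰⊥ coprime (≤-respʳ-≡ p≤c∅z (c-∅ z)))

  cUp-∪ : CondA V X c → ∀ {p} → Coprime p → ∀ A B →
          cUp V X c p (_∪_ V X A B) ⊆ _∪_ V X (cUp V X c p A) (cUp V X c p B)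
  cUp-∪ (_ , c-∪) (_ , split) A B {z} p≤cABz = split _ _ (≤-respʳ-≡ p≤cABz (c-∪ A B z))

module BarredOperator {ℓ : Level} (V : Quantale ℓ) (X : Set ℓ)
  (c : Pred X ℓ → X → Quantale.Carrier V) where
  open Quantale V
  open QuantaleProperties V
  open OperatorProperties V X c

  c̄ : Pred X ℓ → X → Carrier
  c̄ = cBar V X c

  cᵛ : Carrier → Pred X ℓ → Pred X ℓ
  cᵛ = cUp V X c

  c̄-upper : ∀ A x v → v ⊗ c (cᵛ v A) x ≤ c̄ A x
  c̄-upper A x v = ⋁-upper _ _ (v , refl)

  c̄-least : ∀ A x {y} → (∀ v → v ⊗ c (cᵛ v A) x ≤ y) → c̄ A x ≤ y
  c̄-least A x bound = ⋁-least _ _ λ { _ (v , refl) → bound v }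

  c̄-mono : Monotone → ∀ {A B} → A ⊆ B → ∀ x → c̄ A x ≤ c̄ B x
  c̄-mono mono {A} {B} A⊆B x = c̄-least A x λ v →
    ≤-trans (⊗-monoʳ-≤ v (mono (λ v≤cAz → ≤-trans v≤cAz (mono A⊆B _)) x)) (c̄-upper B x v)

  c̄-least-by-coprimes : CoprimeGenerated → Monotone → ∀ A x {y} →
                        (∀ p → Coprime p → p ⊗ c (cᵛ p A) x ≤ y) → c̄ A x ≤ y
  c̄-least-by-coprimes coprimeGenerated mono A x {y} bound = c̄-least A x λ v →
    ⊗-≤-by-coprimes coprimeGenerated v _ y λ p coprime p≤v →
      ≤-trans (⊗-monoʳ-≤ p (mono (cUp-antitone A p≤v) x)) (bound p coprime)

  c̄-reflexive : CondR V X c → CondR V X c̄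
  c̄-reflexive condR A x x∈A =
    ≤-trans (condR (cᵛ k A) x (condR A x x∈A))
            (≤-respˡ-≡ (sym (⊗-identityˡ _)) (c̄-upper A x k))

  c̄-∅ : CoprimeGenerated → Monotone → CondA V X c → ∀ x → c̄ (∅ V X) x ≡ ⊥V
  c̄-∅ coprimeGenerated mono additive@(c-∅ , _) x =
    antisym (c̄-least-by-coprimes coprimeGenerated mono (∅ V X) x λ p coprime →
               ≤-respʳ-≡ (⊗-monoʳ-≤ p (≤-respʳ-≡ (mono (cUp-∅ additive coprime) x) (c-∅ x)))
                         (⊗-zeroʳ p))
            (⊥V-least _)

  c̄-∪ : CoprimeGenerated → Monotone → CondA V X c →
        ∀ A B x → c̄ (_∪_ V X A B) x ≡ c̄ A x ∨ c̄ B x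
  c̄-∪ coprimeGenerated mono additive@(_ , c-∪) A B x =
    antisym (c̄-least-by-coprimes coprimeGenerated mono (_∪_ V X A B) x λ p coprime →
               ≤-trans (⊗-monoʳ-≤ p (≤-respʳ-≡ (mono (cUp-∪ additive coprime A B) x)
                                                (c-∪ (cᵛ p A) (cᵛ p B) x)))
                       (≤-trans (⊗-distribˡ-∨-≤ p _ _)
                                (∨-mono-≤ (c̄-upper A x p) (c̄-upper B x p))))
            (∨-least (c̄-mono mono inj₁ x) (c̄-mono mono inj₂ x))

proposition2p6 : {ℓ : Level} (V : Quantale ℓ) (X : Set ℓ) →
    Quantale.CoprimeGenerated V →
    (c : Pred X ℓ → X → Quantale.Carrier V) →
    Extensional V X c →
    CondR V X c →
    CondA V X c →
    CondR V X (cBar V X c) × CondA V X (cBar V X c)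
proposition2p6 V X coprimeGenerated c ext condR additive =
  c̄-reflexive condR ,
  c̄-∅ coprimeGenerated mono additive ,
  c̄-∪ coprimeGenerated mono additive
  where
  open OperatorProperties V X c
  open BarredOperator V X c
  mono : Monotone
  mono = extensional∧additive⇒monotone ext additive
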